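{- Let $\pi\in{\cal S}_n$. Then the words $\pi_{\sf d}$ and $\pi_{\sf nd}$ are both increasing if and only if $\pi$ is bi-increasing and ${\sf exc}(\pi)={\sf des}(\pi)$.
   Context: Permutations $\pi\in{\cal S}_n$ are written as words $\pi_1\cdots\pi_n$. An excedance of $\pi$ is an integer $i\in[n-1]$ with $\pi_i>i$; ${\sf E}(\pi)$ is the set of excedances, ${\sf exc}(\pi)=|{\sf E}(\pi)|$, ${\sf dexc}(\pi)=\sum_{i\in{\sf E}(\pi)}(\pi_i-i)$, and ${\sf inv}(\pi)$ is the number of pairs $i<j$ with $\pi_i>\pi_j$. A permutation is bi-increasing if ${\sf inv}(\pi)={\sf dexc}(\pi)$. A descent is an $i\in[n-1]$ with $\pi_i>\pi_{i+1}$, and then $\pi_i$ is called a descent top; ${\sf des}(\pi)$ is the number of descents. $\pi_{\sf d}$ is the subword of $\pi$ consisting of all descent tops (in order of appearance) and $\pi_{\sf nd}$ is the subword consisting of the remaining letters. -}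

module Defs where

open import Data.Nat using (ℕ; zero; suc; _+_; _∸_; _<_; _<?_)
open import Data.Fin using (Fin; toℕ)
open import Data.Fin.Permutation using (Permutation′; _⟨$⟩ʳ_)
open import Data.List using (List; []; _∷_; map; filter; length; allFin; concatMap)
open import Data.Nat.ListAction using (sum)
open import Data.Bool using (true; false; if_then_else_)
open import Relation.Binary.PropositionalEquality using (_≡_)
open import Data.List.Relation.Unary.Linked using (Linked)
open import Data.Product using (_×_; _,_; proj₁; proj₂)
open import Relation.Nullary using (does)

-- A permutation π ∈ S_n, with positions and values taken in [n] = {1,…,n}.
-- Position of index i : Fin n is 1 + toℕ i.
pos : {n : ℕ} → Fin n → ℕ
pos i = suc (toℕ i)

val : {n : ℕ} → Permutation′ n → Fin n → ℕ
val π i = suc (toℕ (π ⟨$⟩ʳ i))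

word : {n : ℕ} → Permutation′ n → List ℕ
word {n} π = map (val π) (allFin n)

-- Excedances: positions i with π_i > i (such i automatically lie in [n-1]).
excSet : {n : ℕ} → Permutation′ n → List (Fin n)
excSet {n} π = filter (λ i → pos i <? val π i) (allFin n)

exc : {n : ℕ} → Permutation′ n → ℕ
exc π = length (excSet π)

dexc : {n : ℕ} → Permutation′ n → ℕ
dexc π = sum (map (λ i → val π i ∸ pos i) (excSet π))

pairs : (n : ℕ) → List (Fin n × Fin n)
pairs n = concatMap (λ i → map (λ j → (i , j)) (allFin n)) (allFin n)

inv : {n : ℕ} → Permutation′ n → ℕ
inv {n} π = length (filter (λ p → pos (proj₁ p) <? pos (proj₂ p))
                    (filter (λ p → val π (proj₂ p) <? val π (proj₁ p)) (pairs n)))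

BiIncreasing : {n : ℕ} → Permutation′ n → Set
BiIncreasing π = inv π ≡ dexc π

desFrom : ℕ → List ℕ → ℕ
desFrom x [] = 0
desFrom x (y ∷ r) = (if does (y <? x) then 1 else 0) + desFrom y r

desW : List ℕ → ℕ
desW [] = 0
desW (x ∷ r) = desFrom x r

des : {n : ℕ} → Permutation′ n → ℕ
des π = desW (word π)

dTopsFrom : ℕ → List ℕ → List ℕ
dTopsFrom x [] = []
dTopsFrom x (y ∷ r) = if does (y <? x) then x ∷ dTopsFrom y r else dTopsFrom y r

dTops : List ℕ → List ℕ
dTops [] = []
dTops (x ∷ r) = dTopsFrom x r

-- Subword of the remaining letters (including the last letter).
ndFrom : ℕ → List ℕ → List ℕ
ndFrom x [] = x ∷ []
ndFrom x (y ∷ r) = if does (y <? x) then ndFrom y r else x ∷ ndFrom y r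

ndLetters : List ℕ → List ℕ
ndLetters [] = []
ndLetters (x ∷ r) = ndFrom x r

πd : {n : ℕ} → Permutation′ n → List ℕ
πd π = dTops (word π)

πnd : {n : ℕ} → Permutation′ n → List ℕ
πnd π = ndLetters (word π)

Increasing : List ℕ → Set
Increasing = Linked _<_

-- For a position i let c i count the inversions (i , j) and g i the inversions (j , i).
-- Counting the j with π j < π i and the j with j < i gives c i + i = π i + g i, so c i is at
-- least π i ∸ i, the contribution of i to dexc; hence π is bi-increasing iff c i = π i ∸ i at
-- every position. A descent at i is itself an inversion (i , i + 1), so every descent is then an
-- excedance, and exc = des makes descents and excedances coincide. Through the balance identity
-- these conditions say that g i = 0 (π i is a left-to-right maximum) at the descents and c i = 0
-- (π i is a right-to-left minimum) elsewhere, which is exactly what makes π_d and π_nd increasing.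
module Submission where

open import Defs
open import Data.Nat using (ℕ; zero; suc; _+_; _∸_; _<_; _≤_; _<?_; _<ᵇ_; z≤n; s≤s)
open import Data.Nat.Properties
  using (<ᵇ⇒<; <⇒<ᵇ; <ᵇ-reflects-<; <-trans; <-≤-trans; ≤-<-trans; <-asym; <-irrefl; ≤-refl; ≤-trans;
         ≤-reflexive; ≤-antisym; <⇒≤; ≮⇒≥; ≤∧≢⇒<; ≤⇒≯; +-cancelˡ-≡; +-cancelʳ-≤; +-monoʳ-≤; +-mono-≤;
         +-assoc; +-comm; +-identityʳ; m≤m+n; m≤n+o⇒m∸n≤o; m+n∸n≡m; m∸n+n≡m; m≤n⇒m∸n≡0; m∸n≢0⇒n<m;
         suc-injective; +-0-commutativeMonoid; module ≤-Reasoning)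
open import Data.Nat.ListAction using (sum)
open import Data.Nat.ListAction.Properties using (sum-++)
open import Data.Fin using (Fin; zero; suc; toℕ)
open import Data.Fin.Properties using (toℕ<n; toℕ-injective)
open import Data.Fin.Permutation using (Permutation′; _⟨$⟩ʳ_)
open import Data.Bool using (Bool; true; false; T; not; _∧_; if_then_else_)
open import Data.Bool.Properties using (∧-comm; T-≡)
open import Data.Product using (∃-syntax; _×_; _,_; proj₁; proj₂; uncurry)
open import Data.Product.Function.NonDependent.Propositional using (_×-⇔_)
open import Data.Sum using (_⊎_; inj₁; inj₂)
open import Data.Unit using (tt)
open import Data.Empty using (⊥-elim)
open import Data.List using (List; []; _∷_; _++_; map; filter; length; tabulate; allFin; concatMap)
open import Data.List.Properties using (map-tabulate; map-++; map-cong; map-∘)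
open import Data.List.Relation.Unary.All using (All; []; _∷_)
open import Data.List.Relation.Unary.AllPairs using (AllPairs; []; _∷_)
open import Data.List.Relation.Unary.Linked.Properties using (AllPairs⇒Linked; Linked⇒AllPairs)
open import Function using (_∘_; id; const)
open import Function.Bundles using (_⇔_; mk⇔; Equivalence; Injection)
open import Function.Construct.Composition using (_⇔-∘_)
open import Function.Construct.Symmetry using (⇔-sym)
open import Function.Properties.Inverse using (↔⇒↣)
open import Relation.Nullary using (does; ¬_; Dec)
open import Relation.Nullary.Reflects using (ofʸ; ofⁿ)
open import Relation.Unary using (Decidable)
open import Relation.Binary.PropositionalEquality
  using (_≡_; _≢_; refl; cong; sym; trans; subst; module ≡-Reasoning)
open import Algebra.Properties.CommutativeMonoid.Sum +-0-commutativeMonoid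
  using (sum-syntax; sum-cong-≗; sum-replicate-zero; ∑-distrib-+; ∑-permute)
  renaming (sum to ∑)

𝟙 : Bool → ℕ
𝟙 b = if b then 1 else 0

+-mono-≤-equality : ∀ {a b c d} → a ≤ b → c ≤ d → a + c ≡ b + d → a ≡ b × c ≡ d
+-mono-≤-equality {a} {b} {c} {d} a≤b c≤d eq = a≡b , +-cancelˡ-≡ a c d (trans eq (cong (_+ d) (sym a≡b)))
  where
  a≡b : a ≡ b
  a≡b = ≤-antisym a≤b (+-cancelʳ-≤ d b a (≤-trans (≤-reflexive (sym eq)) (+-monoʳ-≤ a c≤d)))

∑-mono-≤ : ∀ {n} {a b : Fin n → ℕ} → (∀ i → a i ≤ b i) → ∑ a ≤ ∑ b
∑-mono-≤ {zero}  a≤b = z≤n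
∑-mono-≤ {suc n} a≤b = +-mono-≤ (a≤b zero) (∑-mono-≤ (a≤b ∘ suc))

∑-mono-≤-equality : ∀ {n} {a b : Fin n → ℕ} → (∀ i → a i ≤ b i) → ∑ a ≡ ∑ b → ∀ i → a i ≡ b i
∑-mono-≤-equality {suc n} a≤b eq with +-mono-≤-equality (a≤b zero) (∑-mono-≤ (a≤b ∘ suc)) eq
... | head≡ , tail≡ = λ where
  zero    → head≡
  (suc i) → ∑-mono-≤-equality (a≤b ∘ suc) tail≡ i

∑≡0⇒≗0 : ∀ {n} (a : Fin n → ℕ) → ∑ a ≡ 0 → ∀ i → a i ≡ 0
∑≡0⇒≗0 {n} a eq i = sym (∑-mono-≤-equality (λ _ → z≤n) (trans (sum-replicate-zero n) (sym eq)) i)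

≗0⇒∑≡0 : ∀ {n} (a : Fin n → ℕ) → (∀ i → a i ≡ 0) → ∑ a ≡ 0
≗0⇒∑≡0 {n} a a≗0 = trans (sum-cong-≗ a≗0) (sum-replicate-zero n)

∑-count-< : ∀ n {m} → m ≤ n → ∑[ k < n ] 𝟙 (toℕ k <ᵇ m) ≡ m
∑-count-< zero    z≤n       = refl
∑-count-< (suc n) {zero}  _ = ∑-count-< n z≤n
∑-count-< (suc n) {suc m} (s≤s m≤n) = cong suc (∑-count-< n m≤n)

𝟙-mono : ∀ {a b} → (T a → T b) → 𝟙 a ≤ 𝟙 b
𝟙-mono {false}         _   = z≤n
𝟙-mono {true}  {true}  _   = ≤-refl
𝟙-mono {true}  {false} a⇒b = ⊥-elim (a⇒b tt)

𝟙≡𝟙⇔T⇔T : ∀ {a b} → 𝟙 a ≡ 𝟙 b ⇔ (T a ⇔ T b)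
𝟙≡𝟙⇔T⇔T {false} {false} = mk⇔ (λ _ → mk⇔ id id) (λ _ → refl)
𝟙≡𝟙⇔T⇔T {true}  {true}  = mk⇔ (λ _ → mk⇔ id id) (λ _ → refl)
𝟙≡𝟙⇔T⇔T {false} {true}  = mk⇔ (λ ()) (λ a⇔b → ⊥-elim (Equivalence.from a⇔b tt))
𝟙≡𝟙⇔T⇔T {true}  {false} = mk⇔ (λ ()) (λ a⇔b → ⊥-elim (Equivalence.to a⇔b tt))

𝟙-∧≡0⇔ : ∀ {a b} → 𝟙 (a ∧ b) ≡ 0 ⇔ (T a → ¬ T b)
𝟙-∧≡0⇔ {true}  {true}  = mk⇔ (λ ()) (λ a⇒¬b → ⊥-elim (a⇒¬b tt tt))
𝟙-∧≡0⇔ {true}  {false} = mk⇔ (λ _ _ ()) (λ _ → refl)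
𝟙-∧≡0⇔ {false}         = mk⇔ (λ _ ()) (λ _ → refl)

T<ᵇ⇔< : ∀ {m n} → T (m <ᵇ n) ⇔ m < n
T<ᵇ⇔< = mk⇔ (<ᵇ⇒< _ _) <⇒<ᵇ

T-not⇒¬T : ∀ {b} → T (not b) → ¬ T b
T-not⇒¬T {true}  ()
T-not⇒¬T {false} _ ()

if-then-𝟙-else-0 : ∀ a b → (if a then 𝟙 b else 0) ≡ 𝟙 (a ∧ b)
if-then-𝟙-else-0 true  b = refl
if-then-𝟙-else-0 false b = refl

𝟙<ᵇ-split : ∀ x y u v → (u ≡ v → x ≡ y) →
            𝟙 (x <ᵇ y) ≡ 𝟙 ((x <ᵇ y) ∧ (u <ᵇ v)) + 𝟙 ((x <ᵇ y) ∧ (v <ᵇ u))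
𝟙<ᵇ-split x y u v u≡v⇒x≡y with x <ᵇ y | <ᵇ-reflects-< x y
... | false | _ = refl
... | true  | ofʸ x<y with u <ᵇ v | <ᵇ-reflects-< u v | v <ᵇ u | <ᵇ-reflects-< v u
...   | true  | ofʸ u<v | true  | ofʸ v<u = ⊥-elim (<-asym u<v v<u)
...   | true  | _       | false | _       = refl
...   | false | _       | true  | _       = refl
...   | false | ofⁿ u≮v | false | ofⁿ v≮u =
  ⊥-elim (<-irrefl (u≡v⇒x≡y (≤-antisym (≮⇒≥ v≮u) (≮⇒≥ u≮v))) x<y)

T⊎T-not : ∀ b → T b ⊎ T (not b)
T⊎T-not true  = inj₁ tt
T⊎T-not false = inj₂ tt

sum-tabulate : ∀ {n} (f : Fin n → ℕ) → sum (tabulate f) ≡ ∑ f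
sum-tabulate {zero}  f = refl
sum-tabulate {suc n} f = cong (f zero +_) (sum-tabulate (f ∘ suc))

sum-map-allFin : ∀ {n} (f : Fin n → ℕ) → sum (map f (allFin n)) ≡ ∑ f
sum-map-allFin f = trans (cong sum (map-tabulate id f)) (sum-tabulate f)

module _ {a p} {A : Set a} {P : A → Set p} (P? : Decidable P) where

  length-filter≡sum : ∀ xs → length (filter P? xs) ≡ sum (map (𝟙 ∘ does ∘ P?) xs)
  length-filter≡sum []       = refl
  length-filter≡sum (x ∷ xs) with does (P? x)
  ... | true  = cong suc (length-filter≡sum xs)
  ... | false = length-filter≡sum xs

  sum-map-filter : ∀ (f : A → ℕ) xs →
                   sum (map f (filter P? xs)) ≡ sum (map (λ x → if does (P? x) then f x else 0) xs)
  sum-map-filter f []       = refl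
  sum-map-filter f (x ∷ xs) with does (P? x)
  ... | true  = cong (f x +_) (sum-map-filter f xs)
  ... | false = sum-map-filter f xs

sum-map-concatMap : ∀ {a b} {A : Set a} {B : Set b} (f : B → ℕ) (g : A → List B) xs →
                    sum (map f (concatMap g xs)) ≡ sum (map (sum ∘ map f ∘ g) xs)
sum-map-concatMap f g []       = refl
sum-map-concatMap f g (x ∷ xs) = begin
  sum (map f (g x ++ concatMap g xs))                ≡⟨ cong sum (map-++ f (g x) _) ⟩
  sum (map f (g x) ++ map f (concatMap g xs))        ≡⟨ sum-++ (map f (g x)) _ ⟩
  sum (map f (g x)) + sum (map f (concatMap g xs))   ≡⟨ cong (sum (map f (g x)) +_) (sum-map-concatMap f g xs) ⟩
  sum (map f (g x)) + sum (map (sum ∘ map f ∘ g) xs) ∎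
  where open ≡-Reasoning

sum-map-cong : ∀ {a} {A : Set a} {f g : A → ℕ} → (∀ x → f x ≡ g x) →
               ∀ xs → sum (map f xs) ≡ sum (map g xs)
sum-map-cong f≗g xs = cong sum (map-cong f≗g xs)

select : ∀ {a} {A : Set a} {n} → (Fin n → Bool) → (Fin n → A) → List A
select {n = zero}  b f = []
select {n = suc n} b f =
  if b zero then f zero ∷ select (b ∘ suc) (f ∘ suc) else select (b ∘ suc) (f ∘ suc)

module _ {a p} {A : Set a} (P : A → Set p) where

  All-select⁺ : ∀ {n} (b : Fin n → Bool) (f : Fin n → A) →
                (∀ i → T (b i) → P (f i)) → All P (select b f)
  All-select⁺ {zero}  b f h = []
  All-select⁺ {suc n} b f h with b zero in eq
  ... | true  = h zero (Equivalence.from T-≡ eq) ∷ All-select⁺ (b ∘ suc) (f ∘ suc) (h ∘ suc)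
  ... | false = All-select⁺ (b ∘ suc) (f ∘ suc) (h ∘ suc)

  All-select⁻ : ∀ {n} (b : Fin n → Bool) (f : Fin n → A) →
                All P (select b f) → ∀ i → T (b i) → P (f i)
  All-select⁻ {suc n} b f ps i bi with b zero in eq
  All-select⁻ {suc n} b f (p ∷ ps) zero    _  | true  = p
  All-select⁻ {suc n} b f (p ∷ ps) (suc i) bi | true  = All-select⁻ (b ∘ suc) (f ∘ suc) ps i bi
  All-select⁻ {suc n} b f ps       zero    bi | false = ⊥-elim (subst T eq bi)
  All-select⁻ {suc n} b f ps       (suc i) bi | false = All-select⁻ (b ∘ suc) (f ∘ suc) ps i bi

module _ {a r} {A : Set a} (R : A → A → Set r) where

  AllPairs-select⁺ : ∀ {n} (b : Fin n → Bool) (f : Fin n → A) →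
    (∀ {i j} → toℕ i < toℕ j → T (b i) → T (b j) → R (f i) (f j)) → AllPairs R (select b f)
  AllPairs-select⁺ {zero}  b f h = []
  AllPairs-select⁺ {suc n} b f h with b zero in eq
  ... | true  = All-select⁺ (R (f zero)) (b ∘ suc) (f ∘ suc) (λ j → h (s≤s z≤n) (Equivalence.from T-≡ eq))
              ∷ AllPairs-select⁺ (b ∘ suc) (f ∘ suc) (h ∘ s≤s)
  ... | false = AllPairs-select⁺ (b ∘ suc) (f ∘ suc) (h ∘ s≤s)

  AllPairs-select⁻ : ∀ {n} (b : Fin n → Bool) (f : Fin n → A) → AllPairs R (select b f) →
    ∀ {i j} → toℕ i < toℕ j → T (b i) → T (b j) → R (f i) (f j)
  AllPairs-select⁻ {suc n} b f rs {i} {j} i<j bi bj with b zero in eq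
  AllPairs-select⁻ {suc n} b f (r ∷ rs) {zero}  {suc j} _         _  bj | true  =
    All-select⁻ (R (f zero)) (b ∘ suc) (f ∘ suc) r j bj
  AllPairs-select⁻ {suc n} b f (r ∷ rs) {suc i} {suc j} (s≤s i<j) bi bj | true  =
    AllPairs-select⁻ (b ∘ suc) (f ∘ suc) rs i<j bi bj
  AllPairs-select⁻ {suc n} b f rs       {zero}  {suc j} _         bi _  | false = ⊥-elim (subst T eq bi)
  AllPairs-select⁻ {suc n} b f rs       {suc i} {suc j} (s≤s i<j) bi bj | false =
    AllPairs-select⁻ (b ∘ suc) (f ∘ suc) rs i<j bi bj

IncreasingOn : ∀ {n} → (Fin n → Bool) → (Fin n → ℕ) → Set
IncreasingOn b f = ∀ {i j} → toℕ i < toℕ j → T (b i) → T (b j) → f i < f j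

increasing-select⇔ : ∀ {n} (b : Fin n → Bool) (f : Fin n → ℕ) →
                     Increasing (select b f) ⇔ IncreasingOn b f
increasing-select⇔ b f = mk⇔
  (AllPairs-select⁻ _<_ b f ∘ Linked⇒AllPairs <-trans)
  (AllPairs⇒Linked ∘ AllPairs-select⁺ _<_ b f)

descent : ∀ {n} → (Fin n → ℕ) → Fin n → Bool
descent {suc zero}    f zero    = false
descent {suc (suc n)} f zero    = does (f (suc zero) <? f zero)
descent {suc (suc n)} f (suc i) = descent (f ∘ suc) i

dTops-tabulate : ∀ {n} (f : Fin n → ℕ) → dTops (tabulate f) ≡ select (descent f) f
dTops-tabulate {zero}        f = refl
dTops-tabulate {suc zero}    f = refl
dTops-tabulate {suc (suc n)} f =
  cong (λ w → if descent f zero then f zero ∷ w else w) (dTops-tabulate (f ∘ suc))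

if-not : ∀ {a} {A : Set a} b {x y : A} → (if b then y else x) ≡ (if not b then x else y)
if-not true  = refl
if-not false = refl

ndLetters-tabulate : ∀ {n} (f : Fin n → ℕ) → ndLetters (tabulate f) ≡ select (not ∘ descent f) f
ndLetters-tabulate {zero}        f = refl
ndLetters-tabulate {suc zero}    f = refl
ndLetters-tabulate {suc (suc n)} f = trans
  (cong (λ w → if descent f zero then w else f zero ∷ w) (ndLetters-tabulate (f ∘ suc)))
  (if-not (descent f zero))

descent⇒inversion : ∀ {n} (f : Fin n → ℕ) i → T (descent f i) →
                    ∃[ j ] toℕ i < toℕ j × f j < f i
descent⇒inversion {suc (suc n)} f zero    d = suc zero , s≤s z≤n , <ᵇ⇒< _ _ d
descent⇒inversion {suc (suc n)} f (suc i) d =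
  let j , i<j , fj<fi = descent⇒inversion (f ∘ suc) i d in suc j , s≤s i<j , fj<fi

nonDescent-below : ∀ {n} (f : Fin n → ℕ) i →
                   ∃[ m ] toℕ i ≤ toℕ m × T (not (descent f m)) × f m ≤ f i
nonDescent-below {suc zero}    f zero = zero , z≤n , tt , ≤-refl
nonDescent-below {suc (suc n)} f zero with T⊎T-not (descent f zero) | nonDescent-below (f ∘ suc) zero
... | inj₁ d  | m , _ , m∉D , fm≤f1 = suc m , z≤n , m∉D , <⇒≤ (≤-<-trans fm≤f1 (<ᵇ⇒< _ _ d))
... | inj₂ nd | _ = zero , z≤n , nd , ≤-refl
nonDescent-below {suc (suc n)} f (suc i) with nonDescent-below (f ∘ suc) i
... | m , i≤m , m∉D , fm≤fi = suc m , s≤s i≤m , m∉D , fm≤fi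

desW-tabulate : ∀ {n} (f : Fin n → ℕ) → desW (tabulate f) ≡ ∑[ i < n ] 𝟙 (descent f i)
desW-tabulate {zero}        f = refl
desW-tabulate {suc zero}    f = refl
desW-tabulate {suc (suc n)} f = cong (𝟙 (descent f zero) +_) (desW-tabulate (f ∘ suc))

IsLeftToRightMaximum : ∀ {n} → (Fin n → ℕ) → Fin n → Set
IsLeftToRightMaximum f i = ∀ {j} → toℕ j < toℕ i → f j < f i

IsRightToLeftMinimum : ∀ {n} → (Fin n → ℕ) → Fin n → Set
IsRightToLeftMinimum f i = ∀ {j} → toℕ i < toℕ j → f i < f j

DescentTopsAreLeftToRightMaxima : ∀ {n} → (Fin n → ℕ) → Set
DescentTopsAreLeftToRightMaxima f = ∀ i → T (descent f i) → IsLeftToRightMaximum f i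

NonDescentsAreRightToLeftMinima : ∀ {n} → (Fin n → ℕ) → Set
NonDescentsAreRightToLeftMinima f = ∀ i → T (not (descent f i)) → IsRightToLeftMinimum f i

module _ {n} (f : Fin n → ℕ) where

  increasingOn-descents⇒ : IncreasingOn (descent f) f → IncreasingOn (not ∘ descent f) f →
                           DescentTopsAreLeftToRightMaxima f × NonDescentsAreRightToLeftMinima f
  increasingOn-descents⇒ tops nonTops = leftMaxima , rightMinima
    where
    rightMinima : NonDescentsAreRightToLeftMinima f
    rightMinima i i∉D {j} i<j with nonDescent-below f j
    ... | m , j≤m , m∉D , fm≤fj = <-≤-trans (nonTops (<-≤-trans i<j j≤m) i∉D m∉D) fm≤fj

    leftMaxima : DescentTopsAreLeftToRightMaxima f
    leftMaxima i i∈D {j} j<i with T⊎T-not (descent f j) | descent⇒inversion f i i∈D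
    ... | inj₁ j∈D  | _ = tops j<i j∈D i∈D
    -- For a non-descent j, pass to a letter k after i below f i and to a non-descent m at or
    -- after k with f m ≤ f k; then f j < f m because both are letters of π_nd.
    ... | inj₂ j∉D  | k , i<k , fk<fi with nonDescent-below f k
    ...   | m , k≤m , m∉D , fm≤fk =
      <-trans (nonTops (<-≤-trans (<-trans j<i i<k) k≤m) j∉D m∉D) (≤-<-trans fm≤fk fk<fi)

  increasingOn-descents⇐ : DescentTopsAreLeftToRightMaxima f → NonDescentsAreRightToLeftMinima f →
                           IncreasingOn (descent f) f × IncreasingOn (not ∘ descent f) f
  increasingOn-descents⇐ leftMaxima rightMinima =
    (λ i<j _ j∈D → leftMaxima _ j∈D i<j) , (λ i<j i∉D _ → rightMinima _ i∉D i<j)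

  increasing-dTops⇔ : Increasing (dTops (tabulate f)) ⇔ IncreasingOn (descent f) f
  increasing-dTops⇔ rewrite dTops-tabulate f = increasing-select⇔ (descent f) f

  increasing-ndLetters⇔ : Increasing (ndLetters (tabulate f)) ⇔ IncreasingOn (not ∘ descent f) f
  increasing-ndLetters⇔ rewrite ndLetters-tabulate f = increasing-select⇔ (not ∘ descent f) f

  increasing-dTops-ndLetters⇔ :
    (Increasing (dTops (tabulate f)) × Increasing (ndLetters (tabulate f))) ⇔
    (DescentTopsAreLeftToRightMaxima f × NonDescentsAreRightToLeftMinima f)
  increasing-dTops-ndLetters⇔ =
    mk⇔ (uncurry increasingOn-descents⇒) (uncurry increasingOn-descents⇐)
    ⇔-∘ (increasing-dTops⇔ ×-⇔ increasing-ndLetters⇔)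
module _ {n} (π : Permutation′ n) where

  -- 0-based, so val π i is suc (value i); indicators like 𝟙 (value j <ᵇ value i) are
  -- definitionally those produced by the decisions on val and pos in Defs.
  value : Fin n → ℕ
  value i = toℕ (π ⟨$⟩ʳ i)

  -- Truncated subtraction: this is 0 at every position that is not an excedance.
  distance : Fin n → ℕ
  distance i = value i ∸ toℕ i

  value-injective : ∀ {i j} → value i ≡ value j → i ≡ j
  value-injective = Injection.injective (↔⇒↣ π) ∘ toℕ-injective

  <⇒val≢ : ∀ {i j} → toℕ i < toℕ j → val π i ≢ val π j
  <⇒val≢ i<j πi≡πj = <-irrefl (cong toℕ (value-injective (suc-injective πi≡πj))) i<j

  inversionsFrom inversionsTo smallerBefore : Fin n → ℕ
  inversionsFrom i = ∑[ j < n ] 𝟙 ((value j <ᵇ value i) ∧ (toℕ i <ᵇ toℕ j))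
  inversionsTo   i = ∑[ j < n ] 𝟙 ((toℕ j <ᵇ toℕ i) ∧ (value i <ᵇ value j))
  smallerBefore  i = ∑[ j < n ] 𝟙 ((value j <ᵇ value i) ∧ (toℕ j <ᵇ toℕ i))

  ∑-count-smaller-values : ∀ i → ∑[ j < n ] 𝟙 (value j <ᵇ value i) ≡ value i
  ∑-count-smaller-values i = trans
    (sym (∑-permute (λ k → 𝟙 (toℕ k <ᵇ value i)) π))
    (∑-count-< n (<⇒≤ (toℕ<n (π ⟨$⟩ʳ i))))

  value≡smallerBefore+inversionsFrom : ∀ i → value i ≡ smallerBefore i + inversionsFrom i
  value≡smallerBefore+inversionsFrom i = begin
    value i
      ≡⟨ ∑-count-smaller-values i ⟨
    ∑[ j < n ] 𝟙 (value j <ᵇ value i)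
      ≡⟨ sum-cong-≗ (λ j → 𝟙<ᵇ-split (value j) (value i) (toℕ j) (toℕ i) (cong value ∘ toℕ-injective)) ⟩
    ∑[ j < n ] (𝟙 ((value j <ᵇ value i) ∧ (toℕ j <ᵇ toℕ i)) + 𝟙 ((value j <ᵇ value i) ∧ (toℕ i <ᵇ toℕ j)))
      ≡⟨ ∑-distrib-+ {n} _ _ ⟩
    smallerBefore i + inversionsFrom i
      ∎
    where open ≡-Reasoning

  toℕ≡smallerBefore+inversionsTo : ∀ i → toℕ i ≡ smallerBefore i + inversionsTo i
  toℕ≡smallerBefore+inversionsTo i = begin
    toℕ i
      ≡⟨ ∑-count-< n (<⇒≤ (toℕ<n i)) ⟨
    ∑[ j < n ] 𝟙 (toℕ j <ᵇ toℕ i)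
      ≡⟨ sum-cong-≗ (λ j → 𝟙<ᵇ-split (toℕ j) (toℕ i) (value j) (value i) (cong toℕ ∘ value-injective)) ⟩
    ∑[ j < n ] (𝟙 ((toℕ j <ᵇ toℕ i) ∧ (value j <ᵇ value i)) + 𝟙 ((toℕ j <ᵇ toℕ i) ∧ (value i <ᵇ value j)))
      ≡⟨ ∑-distrib-+ {n} _ _ ⟩
    ∑[ j < n ] 𝟙 ((toℕ j <ᵇ toℕ i) ∧ (value j <ᵇ value i)) + inversionsTo i
      ≡⟨ cong (_+ inversionsTo i) (sum-cong-≗ {n} (λ j → cong 𝟙 (∧-comm (toℕ j <ᵇ toℕ i) _))) ⟩
    smallerBefore i + inversionsTo i
      ∎
    where open ≡-Reasoning

  inversion-balance : ∀ i → inversionsFrom i + toℕ i ≡ value i + inversionsTo i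
  inversion-balance i = begin
    c + toℕ i    ≡⟨ cong (c +_) (toℕ≡smallerBefore+inversionsTo i) ⟩
    c + (s + g)  ≡⟨ +-assoc c s g ⟨
    c + s + g    ≡⟨ cong (_+ g) (+-comm c s) ⟩
    s + c + g    ≡⟨ cong (_+ g) (value≡smallerBefore+inversionsFrom i) ⟨
    value i + g  ∎
    where
    open ≡-Reasoning
    c = inversionsFrom i
    s = smallerBefore i
    g = inversionsTo i

  distance≤inversionsFrom : ∀ i → distance i ≤ inversionsFrom i
  distance≤inversionsFrom i = m≤n+o⇒m∸n≤o (value i) (toℕ i) (begin
    value i                          ≤⟨ m≤m+n (value i) (inversionsTo i) ⟩
    value i + inversionsTo i         ≡⟨ inversion-balance i ⟨
    inversionsFrom i + toℕ i         ≡⟨ +-comm (inversionsFrom i) (toℕ i) ⟩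
    toℕ i + inversionsFrom i         ∎)
    where open ≤-Reasoning

  inversionsTo≡0⇒inversionsFrom≡distance : ∀ i → inversionsTo i ≡ 0 → inversionsFrom i ≡ distance i
  inversionsTo≡0⇒inversionsFrom≡distance i g≡0 = begin
    inversionsFrom i                 ≡⟨ m+n∸n≡m (inversionsFrom i) (toℕ i) ⟨
    inversionsFrom i + toℕ i ∸ toℕ i ≡⟨ cong (_∸ toℕ i) (inversion-balance i) ⟩
    value i + inversionsTo i ∸ toℕ i ≡⟨ cong (λ g → value i + g ∸ toℕ i) g≡0 ⟩
    value i + 0 ∸ toℕ i              ≡⟨ cong (_∸ toℕ i) (+-identityʳ (value i)) ⟩
    distance i                       ∎
    where open ≡-Reasoning

  inversionsFrom≡0⇒value≤toℕ : ∀ i → inversionsFrom i ≡ 0 → value i ≤ toℕ i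
  inversionsFrom≡0⇒value≤toℕ i c≡0 = begin
    value i                          ≤⟨ m≤m+n (value i) (inversionsTo i) ⟩
    value i + inversionsTo i         ≡⟨ inversion-balance i ⟨
    inversionsFrom i + toℕ i         ≡⟨ cong (_+ toℕ i) c≡0 ⟩
    toℕ i                            ∎
    where open ≤-Reasoning

  inversionsFrom≡distance⇒inversionsTo≡0 : ∀ i → inversionsFrom i ≡ distance i → toℕ i < value i →
                                           inversionsTo i ≡ 0
  inversionsFrom≡distance⇒inversionsTo≡0 i c≡d i<πi = +-cancelˡ-≡ (value i) _ _ (begin
    value i + inversionsTo i         ≡⟨ inversion-balance i ⟨
    inversionsFrom i + toℕ i         ≡⟨ cong (_+ toℕ i) c≡d ⟩
    distance i + toℕ i               ≡⟨ m∸n+n≡m (<⇒≤ i<πi) ⟩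
    value i                          ≡⟨ +-identityʳ (value i) ⟨
    value i + 0                      ∎)
    where open ≡-Reasoning

  inversionsTo≡0⇔ : ∀ i → inversionsTo i ≡ 0 ⇔ IsLeftToRightMaximum (val π) i
  inversionsTo≡0⇔ i = mk⇔ leftMaximum (≗0⇒∑≡0 _ ∘ noInversion)
    where
    leftMaximum : inversionsTo i ≡ 0 → IsLeftToRightMaximum (val π) i
    leftMaximum g≡0 {j} j<i = ≤∧≢⇒< (≮⇒≥ πi≮πj) (<⇒val≢ j<i)
      where
      πi≮πj : ¬ val π i < val π j
      πi≮πj πi<πj = Equivalence.to 𝟙-∧≡0⇔ (∑≡0⇒≗0 _ g≡0 j) (<⇒<ᵇ j<i) (<⇒<ᵇ πi<πj)
    noInversion : IsLeftToRightMaximum (val π) i → ∀ j → 𝟙 ((toℕ j <ᵇ toℕ i) ∧ (value i <ᵇ value j)) ≡ 0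
    noInversion lrm j = Equivalence.from 𝟙-∧≡0⇔ λ j<i πi<πj →
      <-asym (lrm (<ᵇ⇒< _ _ j<i)) (<ᵇ⇒< (val π i) (val π j) πi<πj)

  inversionsFrom≡0⇔ : ∀ i → inversionsFrom i ≡ 0 ⇔ IsRightToLeftMinimum (val π) i
  inversionsFrom≡0⇔ i = mk⇔ rightMinimum (≗0⇒∑≡0 _ ∘ noInversion)
    where
    rightMinimum : inversionsFrom i ≡ 0 → IsRightToLeftMinimum (val π) i
    rightMinimum c≡0 {j} i<j = ≤∧≢⇒< (≮⇒≥ πj≮πi) (<⇒val≢ i<j)
      where
      πj≮πi : ¬ val π j < val π i
      πj≮πi πj<πi = Equivalence.to 𝟙-∧≡0⇔ (∑≡0⇒≗0 _ c≡0 j) (<⇒<ᵇ πj<πi) (<⇒<ᵇ i<j)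
    noInversion : IsRightToLeftMinimum (val π) i → ∀ j → 𝟙 ((value j <ᵇ value i) ∧ (toℕ i <ᵇ toℕ j)) ≡ 0
    noInversion rlm j = Equivalence.from 𝟙-∧≡0⇔ λ πj<πi i<j →
      <-asym (rlm (<ᵇ⇒< _ _ i<j)) (<ᵇ⇒< (val π j) (val π i) πj<πi)

  descent⇒inversionsFrom≢0 : ∀ i → T (descent (val π) i) → inversionsFrom i ≢ 0
  descent⇒inversionsFrom≢0 i i∈D c≡0 with descent⇒inversion (val π) i i∈D
  ... | j , i<j , πj<πi = <-asym πj<πi (Equivalence.to (inversionsFrom≡0⇔ i) c≡0 i<j)

  word≡tabulate : word π ≡ tabulate (val π)
  word≡tabulate = map-tabulate id (val π)

  des≡∑ : des π ≡ ∑[ i < n ] 𝟙 (descent (val π) i)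
  des≡∑ = trans (cong desW word≡tabulate) (desW-tabulate (val π))

  exc≡∑ : exc π ≡ ∑[ i < n ] 𝟙 (toℕ i <ᵇ value i)
  exc≡∑ = trans (length-filter≡sum _ (allFin n)) (sum-map-allFin {n} _)

  dexc≡∑ : dexc π ≡ ∑ distance
  dexc≡∑ = begin
    dexc π
      ≡⟨ sum-map-filter _ distance (allFin n) ⟩
    sum (map (λ i → if toℕ i <ᵇ value i then distance i else 0) (allFin n))
      ≡⟨ sum-map-cong distance-if (allFin n) ⟩
    sum (map distance (allFin n))
      ≡⟨ sum-map-allFin distance ⟩
    ∑ distance
      ∎
    where
    open ≡-Reasoning
    distance-if : ∀ i → (if toℕ i <ᵇ value i then distance i else 0) ≡ distance i
    distance-if i with toℕ i <ᵇ value i | <ᵇ-reflects-< (toℕ i) (value i)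
    ... | true  | _       = refl
    ... | false | ofⁿ i≮πi = sym (m≤n⇒m∸n≡0 (≮⇒≥ i≮πi))

  inv≡∑ : inv π ≡ ∑ inversionsFrom
  inv≡∑ = begin
    inv π
      ≡⟨ length-filter≡sum isForward? (filter isInverted? (pairs n)) ⟩
    sum (map (𝟙 ∘ does ∘ isForward?) (filter isInverted? (pairs n)))
      ≡⟨ sum-map-filter isInverted? _ (pairs n) ⟩
    sum (map (λ p → if does (isInverted? p) then 𝟙 (does (isForward? p)) else 0) (pairs n))
      ≡⟨ sum-map-cong (λ p → if-then-𝟙-else-0 (does (isInverted? p)) _) (pairs n) ⟩
    sum (map inversionIndicator (pairs n))
      ≡⟨ sum-map-concatMap inversionIndicator (λ i → map (i ,_) (allFin n)) (allFin n) ⟩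
    sum (map (λ i → sum (map inversionIndicator (map (i ,_) (allFin n)))) (allFin n))
      ≡⟨ sum-map-cong (λ i → trans (cong sum (sym (map-∘ (allFin n)))) (sum-map-allFin {n} _)) (allFin n) ⟩
    sum (map inversionsFrom (allFin n))
      ≡⟨ sum-map-allFin inversionsFrom ⟩
    ∑ inversionsFrom
      ∎
    where
    open ≡-Reasoning
    isForward? : (p : Fin n × Fin n) → Dec (pos (proj₁ p) < pos (proj₂ p))
    isForward? (i , j) = pos i <? pos j
    isInverted? : (p : Fin n × Fin n) → Dec (val π (proj₂ p) < val π (proj₁ p))
    isInverted? (i , j) = val π j <? val π i
    inversionIndicator : Fin n × Fin n → ℕ
    inversionIndicator (i , j) = 𝟙 ((value j <ᵇ value i) ∧ (toℕ i <ᵇ toℕ j))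

  InversionsFromAreDistances : Set
  InversionsFromAreDistances = ∀ i → inversionsFrom i ≡ distance i

  DescentsAreExcedances : Set
  DescentsAreExcedances = ∀ i → T (descent (val π) i) ⇔ toℕ i < value i

  descent⇒excedance : ∀ i → inversionsFrom i ≡ distance i → T (descent (val π) i) → toℕ i < value i
  descent⇒excedance i c≡d i∈D = m∸n≢0⇒n<m (descent⇒inversionsFrom≢0 i i∈D ∘ trans c≡d)

  bi-increasing⇔ : BiIncreasing π ⇔ InversionsFromAreDistances
  bi-increasing⇔ = mk⇔ inversionsFrom≗distance
    λ c≗d → trans inv≡∑ (trans (sum-cong-≗ c≗d) (sym dexc≡∑))
    where
    inversionsFrom≗distance : BiIncreasing π → InversionsFromAreDistances
    inversionsFrom≗distance inv≡dexc = sym ∘ ∑-mono-≤-equality distance≤inversionsFrom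
      (trans (sym dexc≡∑) (trans (sym inv≡dexc) inv≡∑))

  exc≡des⇔ : InversionsFromAreDistances → exc π ≡ des π ⇔ DescentsAreExcedances
  exc≡des⇔ c≗d = mk⇔ descentsAreExcedances excedances≡descents
    where
    𝟙-descent≤𝟙-excedance : ∀ i → 𝟙 (descent (val π) i) ≤ 𝟙 (toℕ i <ᵇ value i)
    𝟙-descent≤𝟙-excedance i = 𝟙-mono (<⇒<ᵇ ∘ descent⇒excedance i (c≗d i))

    descentsAreExcedances : exc π ≡ des π → DescentsAreExcedances
    descentsAreExcedances exc≡des i = T<ᵇ⇔< ⇔-∘ Equivalence.to 𝟙≡𝟙⇔T⇔T
      (∑-mono-≤-equality 𝟙-descent≤𝟙-excedance (trans (sym des≡∑) (trans (sym exc≡des) exc≡∑)) i)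

    excedances≡descents : DescentsAreExcedances → exc π ≡ des π
    excedances≡descents d⇔e = trans exc≡∑ (trans (sum-cong-≗ 𝟙-excedance≡𝟙-descent) (sym des≡∑))
      where
      𝟙-excedance≡𝟙-descent : ∀ i → 𝟙 (toℕ i <ᵇ value i) ≡ 𝟙 (descent (val π) i)
      𝟙-excedance≡𝟙-descent i = Equivalence.from 𝟙≡𝟙⇔T⇔T (⇔-sym (d⇔e i) ⇔-∘ T<ᵇ⇔<)

  maxima×minima⇒atPosition :
    DescentTopsAreLeftToRightMaxima (val π) → NonDescentsAreRightToLeftMinima (val π) →
    ∀ i → inversionsFrom i ≡ distance i × (T (descent (val π) i) ⇔ toℕ i < value i)
  maxima×minima⇒atPosition maxima minima i with T⊎T-not (descent (val π) i)
  ... | inj₁ i∈D = c≡d , mk⇔ (const (descent⇒excedance i c≡d i∈D)) (const i∈D)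
    where
    c≡d : inversionsFrom i ≡ distance i
    c≡d = inversionsTo≡0⇒inversionsFrom≡distance i (Equivalence.from (inversionsTo≡0⇔ i) (maxima i i∈D))
  ... | inj₂ i∉D = trans c≡0 (sym (m≤n⇒m∸n≡0 πi≤i)) , mk⇔ (⊥-elim ∘ T-not⇒¬T i∉D) (⊥-elim ∘ ≤⇒≯ πi≤i)
    where
    c≡0 : inversionsFrom i ≡ 0
    c≡0 = Equivalence.from (inversionsFrom≡0⇔ i) (minima i i∉D)
    πi≤i : value i ≤ toℕ i
    πi≤i = inversionsFrom≡0⇒value≤toℕ i c≡0

  atPositions⇒maxima×minima : InversionsFromAreDistances → DescentsAreExcedances →
                              DescentTopsAreLeftToRightMaxima (val π) × NonDescentsAreRightToLeftMinima (val π)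
  atPositions⇒maxima×minima c≗d d⇔e =
    (λ i i∈D → Equivalence.to (inversionsTo≡0⇔ i)
                 (inversionsFrom≡distance⇒inversionsTo≡0 i (c≗d i) (Equivalence.to (d⇔e i) i∈D))) ,
    (λ i i∉D → Equivalence.to (inversionsFrom≡0⇔ i)
                 (trans (c≗d i) (m≤n⇒m∸n≡0 (≮⇒≥ (T-not⇒¬T i∉D ∘ Equivalence.from (d⇔e i))))))

  inversionsAndDescents⇔ :
    (InversionsFromAreDistances × DescentsAreExcedances) ⇔
    (DescentTopsAreLeftToRightMaxima (val π) × NonDescentsAreRightToLeftMinima (val π))
  inversionsAndDescents⇔ = mk⇔ (uncurry atPositions⇒maxima×minima) λ (maxima , minima) →
    let atPosition = maxima×minima⇒atPosition maxima minima in proj₁ ∘ atPosition , proj₂ ∘ atPosition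

  bi-increasing×exc≡des⇔ :
    (BiIncreasing π × exc π ≡ des π) ⇔ (InversionsFromAreDistances × DescentsAreExcedances)
  bi-increasing×exc≡des⇔ = mk⇔
    (λ (bi , exc≡des) → let c≗d = Equivalence.to bi-increasing⇔ bi in
                        c≗d , Equivalence.to (exc≡des⇔ c≗d) exc≡des)
    (λ (c≗d , d⇔e) → Equivalence.from bi-increasing⇔ c≗d , Equivalence.from (exc≡des⇔ c≗d) d⇔e)

  increasing-πd×πnd⇔ : (Increasing (dTops (word π)) × Increasing (ndLetters (word π))) ⇔
                       (DescentTopsAreLeftToRightMaxima (val π) × NonDescentsAreRightToLeftMinima (val π))
  increasing-πd×πnd⇔ rewrite word≡tabulate = increasing-dTops-ndLetters⇔ (val π)

proposition4p1 : (n : ℕ) (π : Permutation′ n) →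
    (Increasing (πd π) × Increasing (πnd π)) ⇔ (BiIncreasing π × exc π ≡ des π)
proposition4p1 n π =
  ⇔-sym (bi-increasing×exc≡des⇔ π) ⇔-∘ (⇔-sym (inversionsAndDescents⇔ π) ⇔-∘ increasing-πd×πnd⇔ π)
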